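{- Let $\lambda$ be a nonnesting set partition of $[n]$ and let $S=\lambda\sqcup\nu$ be a tight splice of $\lambda$. Then $\nu$ is nonnesting.
   Context: $[[n]]=\{(i,j):1\le i<j\le n\}$; $(i,j)\preceq(r,s)$ iff $r\le i<j\le s$. A set partition of $[n]$ is $\lambda\subseteq[[n]]$ with no two distinct elements sharing a first coordinate or sharing a second coordinate; it is nonnesting if no two distinct elements are $\preceq$-comparable. $\uparrow^{2}\lambda=\{(r,s)\in[[n]]:\exists(i,j)\in\lambda,\ r\le i<j\le s,\ s-r\ge j-i+2\}$. For disjoint set partitions $\lambda,\nu$ of $[n]$, $S=\lambda\sqcup\nu$ is a splice of $\lambda$ if (S1) for every $(i,k)\in\nu$ there is $j$, $i<j<k$, with $(i,j)\in\lambda$ or $(j,k)\in\lambda$; (S2) for all $1\le j<k\le n$: there is $i$ with $(i,j)\in\lambda,(i,k)\in\nu$ iff there is $l$ with $(k,l)\in\lambda,(j,l)\in\nu$. A splice of a nonnesting $\lambda$ is tight if $S\cap\uparrow^2\lambda=\emptyset$. -}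

module Defs where

open import Data.Nat using (ℕ; _≤_; _<_; _+_; _∸_)
open import Data.Product using (_×_; ∃; ∃-syntax; _,_)
open import Data.Sum using (_⊎_)
open import Relation.Nullary using (¬_)
open import Relation.Binary.PropositionalEquality using (_≡_)
open import Function.Bundles using (_⇔_)

-- A subset of ℕ × ℕ, given as a (curried) predicate: R i j means (i,j) ∈ R.
Rel₂ : Set₁
Rel₂ = ℕ → ℕ → Set

IsArc : ℕ → ℕ → ℕ → Set
IsArc n i j = (1 ≤ i) × (i < j) × (j ≤ n)

Sub : ℕ → Rel₂ → Set
Sub n R = ∀ i j → R i j → IsArc n i j

IsSetPartition : ℕ → Rel₂ → Set
IsSetPartition n L =
  Sub n L ×
  (∀ i j k → L i j → L i k → j ≡ k) ×
  (∀ i j k → L i j → L k j → i ≡ k)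

_⪯_ : ℕ × ℕ → ℕ × ℕ → Set
(i , j) ⪯ (r , s) = (r ≤ i) × (i < j) × (j ≤ s)

Nonnesting : Rel₂ → Set
Nonnesting L = ∀ i j r s → L i j → L r s → (i , j) ⪯ (r , s) → (i , j) ≡ (r , s)

Up2 : ℕ → Rel₂ → Rel₂
Up2 n L r s = IsArc n r s ×
  (∃[ i ] ∃[ j ] (L i j × (r ≤ i) × (i < j) × (j ≤ s) × ((j ∸ i) + 2 ≤ s ∸ r)))

Disjoint : Rel₂ → Rel₂ → Set
Disjoint L N = ∀ i j → ¬ (L i j × N i j)

Union : Rel₂ → Rel₂ → Rel₂
Union L N i j = L i j ⊎ N i j

SpliceS1 : Rel₂ → Rel₂ → Set
SpliceS1 L N = ∀ i k → N i k → ∃[ j ] ((i < j) × (j < k) × (L i j ⊎ L j k))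

SpliceS2 : ℕ → Rel₂ → Rel₂ → Set
SpliceS2 n L N = ∀ j k → 1 ≤ j → j < k → k ≤ n →
  ((∃[ i ] (L i j × N i k)) ⇔ (∃[ l ] (L k l × N j l)))

IsSplice : ℕ → Rel₂ → Rel₂ → Set
IsSplice n L N =
  IsSetPartition n L × IsSetPartition n N × Disjoint L N ×
  SpliceS1 L N × SpliceS2 n L N

IsTightSplice : ℕ → Rel₂ → Rel₂ → Set
IsTightSplice n L N =
  Nonnesting L × IsSplice n L N × (∀ r s → ¬ (Union L N r s × Up2 n L r s))

-- If (i,j) ⪯ (r,s) are distinct arcs of ν, they cannot share an endpoint
-- (ν is a set partition), so r < i and j < s.  By (S1) the arc (i,j) covers
-- an arc (a,b) of λ, and then s − r ≥ (j − i) + 2 ≥ (b − a) + 2 puts (r,s) in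
-- ↑²λ, contradicting tightness.
module Submission where

open import Defs
open import Data.Nat using (ℕ; zero; suc; _≤_; _<_; _+_; _∸_; s≤s)
open import Data.Nat.Properties
open import Data.Product using (_,_)
open import Data.Sum using (inj₁; inj₂)
open import Data.Empty using (⊥-elim)
open import Relation.Binary.PropositionalEquality using (refl; cong)

span∸+2≤ : ∀ r i j s → r < i → i ≤ j → j < s → (j ∸ i) + 2 ≤ s ∸ r
span∸+2≤ zero (suc i) (suc j) s _ (s≤s i≤j) j<s = begin
  (j ∸ i) + 2 ≡⟨ +-comm (j ∸ i) 2 ⟩
  2 + (j ∸ i) ≤⟨ s≤s (s≤s (m∸n≤m j i)) ⟩
  suc (suc j) ≤⟨ j<s ⟩
  s           ∎
  where open ≤-Reasoning
span∸+2≤ (suc r) (suc i) (suc j) (suc s) (s≤s r<i) (s≤s i≤j) (s≤s j<s) =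
  span∸+2≤ r i j s r<i i≤j j<s

strictlyAround⇒Up2 : ∀ {n L r i a b j s} → IsArc n r s → L a b →
  r < i → i ≤ a → a < b → b ≤ j → j < s → Up2 n L r s
strictlyAround⇒Up2 {r = r} {i} {a} {b} {j} {s} rs Lab r<i i≤a a<b b≤j j<s =
  rs , a , b , Lab , ≤-trans (<⇒≤ r<i) i≤a , a<b , ≤-trans b≤j (<⇒≤ j<s) ,
  ≤-trans (+-monoˡ-≤ 2 (∸-mono b≤j i≤a)) (span∸+2≤ r i j s r<i i≤j j<s)
  where
  i≤j : i ≤ j
  i≤j = ≤-trans i≤a (≤-trans (<⇒≤ a<b) b≤j)

splice-strictlyAround⇒Up2 : ∀ {n L N r i j s} → SpliceS1 L N → N i j →
  IsArc n r s → r < i → j < s → Up2 n L r s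
splice-strictlyAround⇒Up2 {i = i} {j} s1 Nij rs r<i j<s with s1 i j Nij
... | a , i<a , a<j , inj₁ Lia =
  strictlyAround⇒Up2 rs Lia r<i ≤-refl i<a (<⇒≤ a<j) j<s
... | b , i<b , b<j , inj₂ Lbj =
  strictlyAround⇒Up2 rs Lbj r<i (<⇒≤ i<b) b<j ≤-refl j<s

proposition3p3 : (n : ℕ) (L N : Rel₂) →
    IsSetPartition n L → Nonnesting L → IsTightSplice n L N → Nonnesting N
proposition3p3 n L N _ _ (_ , (_ , (N⊆ , N-fst , N-snd) , _ , s1 , _) , tight)
               i j r s Nij Nrs (r≤i , _ , j≤s)
  with m≤n⇒m<n∨m≡n r≤i | m≤n⇒m<n∨m≡n j≤s
... | inj₂ refl | _         = cong (r ,_) (N-fst r j s Nij Nrs)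
... | inj₁ _    | inj₂ refl = cong (_, s) (N-snd i s r Nij Nrs)
... | inj₁ r<i  | inj₁ j<s  =
  ⊥-elim (tight r s (inj₂ Nrs , splice-strictlyAround⇒Up2 s1 Nij (N⊆ r s Nrs) r<i j<s))
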